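{- The class of interval graphs is a strict subclass of the class of proper max-point-tolerance graphs: every interval graph is a proper max-point-tolerance graph, and there is a proper max-point-tolerance graph that is not an interval graph.
   Context: All graphs are finite, simple, undirected. $G=(V,E)$ is a max-point-tolerance graph (MPTG) if each vertex $u$ can be assigned a pair $(I_u,p_u)$, with $I_u$ a closed bounded real interval and $p_u\in I_u$, such that for distinct $u,v$, $uv\in E$ iff $\{p_u,p_v\}\subseteq I_u\cap I_v$. It is a proper MPTG if it has such a representation in which no interval properly contains another.
   Formalization: The intervals of interval graphs and of max-point-tolerance representations have rational endpoints, and the points $p_u$ are rational, instead of real. -}

module Defs where

open import Level using (0ℓ)
open import Data.Nat using (ℕ)
open import Data.Fin using (Fin)
open import Data.Rational using (ℚ; _≤_)
open import Data.Product using (Σ; _×_; ∃)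
open import Data.Empty using (⊥)
open import Relation.Nullary using (¬_)
open import Relation.Binary.PropositionalEquality using (_≡_)
open import Function.Bundles using (_⇔_)

record Graph (n : ℕ) : Set₁ where
  field
    Adj     : Fin n → Fin n → Set
    sym     : ∀ {u v} → Adj u v → Adj v u
    irrefl  : ∀ {u} → ¬ Adj u u
open Graph public

-- A closed bounded (nonempty) interval [lo , hi] of the line.
-- The real line is replaced by ℚ.
record Interval : Set where
  constructor [_,_]⟨_⟩
  field
    lo    : ℚ
    hi    : ℚ
    lo≤hi : lo ≤ hi
open Interval public

_∈I_ : ℚ → Interval → Set
x ∈I I = (lo I ≤ x) × (x ≤ hi I)

_⊆I_ : Interval → Interval → Set
I ⊆I J = ∀ x → x ∈I I → x ∈I J

_⊂I_ : Interval → Interval → Set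
I ⊂I J = (I ⊆I J) × ¬ (J ⊆I I)

IsIntervalGraph : ∀ {n} → Graph n → Set
IsIntervalGraph {n} G =
  Σ (Fin n → Interval) λ I →
    ∀ u v → ¬ (u ≡ v) → (Adj G u v ⇔ ∃ λ x → (x ∈I I u) × (x ∈I I v))

IsMPTGRep : ∀ {n} → Graph n → (Fin n → Interval) → (Fin n → ℚ) → Set
IsMPTGRep {n} G I p =
  (∀ u → p u ∈I I u) ×
  (∀ u v → ¬ (u ≡ v) →
     (Adj G u v ⇔ (((p u ∈I I u) × (p u ∈I I v)) × ((p v ∈I I u) × (p v ∈I I v)))))

IsMPTG : ∀ {n} → Graph n → Set
IsMPTG {n} G = Σ (Fin n → Interval) λ I → Σ (Fin n → ℚ) λ p → IsMPTGRep G I p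

IsProperMPTG : ∀ {n} → Graph n → Set
IsProperMPTG {n} G =
  Σ (Fin n → Interval) λ I → Σ (Fin n → ℚ) λ p →
    IsMPTGRep G I p × (∀ u v → ¬ (I v ⊂I I u))

{-# OPTIONS --safe #-}
module Submission where

-- Interval graph ⇒ proper MPTG: keep every left endpoint l_u, stretch every interval to a
-- common length K large enough that each [l_u , l_u + K] reaches past every right endpoint,
-- and take p_u = r_u.  Then {r_u , r_v} ⊆ I'_u ∩ I'_v says exactly l_u ≤ r_v and l_v ≤ r_u,
-- i.e. that the original intervals overlap, and equal lengths exclude proper containment.
-- The converse fails for the 4-cycle: it is a proper MPTG, but among four intervals that
-- overlap cyclically one of the two diagonal pairs overlaps.

open import Defs
open import Data.Nat as ℕ using (ℕ; _%_)
open import Data.Integer using (+_)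
open import Data.Product using (Σ; _×_; _,_; proj₁; proj₂; ∃)
open import Data.Sum using (_⊎_; inj₁; inj₂; [_,_]′)
open import Data.Fin as Fin using (Fin; toℕ; #_)
open import Data.Fin.Properties using (all?)
open import Data.Vec using (lookup; []; _∷_)
open import Data.List using (tabulate)
open import Data.List.Relation.Unary.All.Properties using (tabulate⁻)
open import Data.Rational using (ℚ; _≤_; _+_; _-_; -_; _⊔_; 0ℚ; _≤?_)
open import Data.Rational.Literals using (fromℤ)
open import Data.Rational.Properties
  using (≤-refl; ≤-trans; ≤-antisym; ≤-total; ≤-decTotalOrder; module ≤-Reasoning;
         +-comm; +-identityʳ; +-monoˡ-≤; +-monoʳ-≤; +-0-group; p≤p⊔q; p≤q⊔p; ⊔-lub)
open import Algebra.Properties.Group +-0-group using (//-rightDividesˡ; //-rightDividesʳ)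
open import Relation.Binary.Bundles using (DecTotalOrder)
open import Data.List.Extrema (DecTotalOrder.totalOrder ≤-decTotalOrder)
  using (max; min; xs≤max; min≤xs)
open import Relation.Binary.PropositionalEquality using (_≡_; refl; cong; subst; subst₂)
import Relation.Binary.PropositionalEquality as ≡
open import Relation.Nullary using (¬_; Dec; ¬?)
open import Relation.Nullary.Decidable using (toWitness; _×-dec_; _→-dec_; map′)
open import Function using (_∘_)
open import Function.Bundles using (_⇔_; mk⇔; Equivalence)
open import Function.Construct.Composition using (_⇔-∘_)
open import Function.Construct.Symmetry using (⇔-sym)

open Equivalence using (to; from)

lo∈I : ∀ J → lo J ∈I J
lo∈I J = ≤-refl , lo≤hi J

hi∈I : ∀ J → hi J ∈I J
hi∈I J = lo≤hi J , ≤-refl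

_∈I?_ : ∀ x J → Dec (x ∈I J)
x ∈I? J = (lo J ≤? x) ×-dec (x ≤? hi J)

_⇔?_ : ∀ {A B : Set} → Dec A → Dec B → Dec (A ⇔ B)
a? ⇔? b? = map′ (λ (f , g) → mk⇔ f g) (λ e → to e , from e) ((a? →-dec b?) ×-dec (b? →-dec a?))

Overlap : Interval → Interval → Set
Overlap A B = ∃ λ x → x ∈I A × x ∈I B

overlap-sym : ∀ A B → Overlap A B → Overlap B A
overlap-sym _ _ (x , x∈A , x∈B) = x , x∈B , x∈A

overlap⇔lo≤hi : ∀ A B → Overlap A B ⇔ (lo A ≤ hi B × lo B ≤ hi A)
overlap⇔lo≤hi A B = mk⇔
  (λ (x , (loA≤x , x≤hiA) , (loB≤x , x≤hiB)) → ≤-trans loA≤x x≤hiB , ≤-trans loB≤x x≤hiA)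
  (λ (loA≤hiB , loB≤hiA) →
    lo A ⊔ lo B , (p≤p⊔q (lo A) (lo B) , ⊔-lub (lo≤hi A) loB≤hiA)
                , (p≤q⊔p (lo A) (lo B) , ⊔-lub loA≤hiB (lo≤hi B)))

separated⇒overlap : ∀ A B C D → hi A ≤ lo C →
  Overlap A B → Overlap B C → Overlap A D → Overlap D C → Overlap B D
separated⇒overlap A B C D hiA≤loC AB BC AD DC = from (overlap⇔lo≤hi B D)
  ( ≤-trans (lo≤hi-of A B AB) (≤-trans hiA≤loC (lo≤hi-of D C DC))
  , ≤-trans (lo≤hi-of A D AD) (≤-trans hiA≤loC (lo≤hi-of B C BC)))
  where
  lo≤hi-of : ∀ X Y → Overlap X Y → lo Y ≤ hi X
  lo≤hi-of X Y = proj₂ ∘ to (overlap⇔lo≤hi X Y)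

cyclicOverlap⇒diagonalOverlap : ∀ A B C D →
  Overlap A B → Overlap B C → Overlap C D → Overlap D A → Overlap A C ⊎ Overlap B D
cyclicOverlap⇒diagonalOverlap A B C D AB BC CD DA with ≤-total (hi A) (lo C)
... | inj₁ hiA≤loC =
  inj₂ (separated⇒overlap A B C D hiA≤loC AB BC (overlap-sym D A DA) (overlap-sym C D CD))
... | inj₂ loC≤hiA with ≤-total (hi C) (lo A)
...   | inj₁ hiC≤loA =
  inj₂ (separated⇒overlap C B A D hiC≤loA (overlap-sym B C BC) (overlap-sym A B AB) CD DA)
...   | inj₂ loA≤hiC = inj₁ (from (overlap⇔lo≤hi A C) (loA≤hiC , loC≤hiA))

+-cancelʳ-≤ : ∀ K {a b} → a + K ≤ b + K → a ≤ b
+-cancelʳ-≤ K {a} {b} = subst₂ _≤_ (//-rightDividesʳ K a) (//-rightDividesʳ K b) ∘ +-monoˡ-≤ (- K)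

p≤p+q : ∀ p {q} → 0ℚ ≤ q → p ≤ p + q
p≤p+q p {q} 0≤q = begin
  p        ≡⟨ ≡.sym (+-identityʳ p) ⟩
  p + 0ℚ   ≤⟨ +-monoʳ-≤ p 0≤q ⟩
  p + q    ∎
  where open ≤-Reasoning

equalLength⇒¬⊂I : ∀ K I J → hi I ≡ lo I + K → hi J ≡ lo J + K → ¬ (J ⊂I I)
equalLength⇒¬⊂I K I J hiI hiJ (J⊆I , I⊈J) = I⊈J I⊆J
  where
  lo-eq : lo I ≡ lo J
  lo-eq = ≤-antisym (proj₁ (J⊆I (lo J) (lo∈I J)))
    (+-cancelʳ-≤ K (subst₂ _≤_ hiJ hiI (proj₂ (J⊆I (hi J) (hi∈I J)))))

  hi-eq : hi I ≡ hi J
  hi-eq = ≡.trans hiI (≡.trans (cong (_+ K) lo-eq) (≡.sym hiJ))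

  I⊆J : I ⊆I J
  I⊆J x (loI≤x , x≤hiI) = subst (_≤ x) lo-eq loI≤x , subst (x ≤_) hi-eq x≤hiI

MPTAdjacent : ∀ {n} → (Fin n → Interval) → (Fin n → ℚ) → Fin n → Fin n → Set
MPTAdjacent I p u v = ((p u ∈I I u) × (p u ∈I I v)) × ((p v ∈I I u) × (p v ∈I I v))

upperBound : ∀ {n} (f : Fin n → ℚ) → ∃ λ M → ∀ i → f i ≤ M
upperBound f = max 0ℚ (tabulate f) , tabulate⁻ (xs≤max 0ℚ (tabulate f))

lowerBound : ∀ {n} (f : Fin n → ℚ) → ∃ λ m → ∀ i → m ≤ f i
lowerBound f = min 0ℚ (tabulate f) , tabulate⁻ (min≤xs 0ℚ (tabulate f))

spreadBound : ∀ {n} (l r : Fin n → ℚ) → ∃ λ K → ∀ u v → r v ≤ l u + K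
spreadBound l r with upperBound r | lowerBound l
... | M , r≤M | m , m≤l = M - m , bound
  where
  open ≤-Reasoning
  bound : ∀ u v → r v ≤ l u + (M - m)
  bound u v = begin
    r v             ≤⟨ r≤M v ⟩
    M               ≡⟨ ≡.sym (//-rightDividesˡ m M) ⟩
    (M - m) + m     ≤⟨ +-monoʳ-≤ (M - m) (m≤l u) ⟩
    (M - m) + l u   ≡⟨ +-comm (M - m) (l u) ⟩
    l u + (M - m)   ∎

module Stretch {n} (I : Fin n → Interval) (K : ℚ) (bound : ∀ u v → hi (I v) ≤ lo (I u) + K) where

  stretched : Fin n → Interval
  stretched u = [ lo (I u) , lo (I u) + K ]⟨ ≤-trans (lo≤hi (I u)) (bound u u) ⟩

  hi∈stretched : ∀ u → hi (I u) ∈I stretched u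
  hi∈stretched u = lo≤hi (I u) , bound u u

  mptAdjacent⇔lo≤hi : ∀ u v →
    MPTAdjacent stretched (hi ∘ I) u v ⇔ (lo (I u) ≤ hi (I v) × lo (I v) ≤ hi (I u))
  mptAdjacent⇔lo≤hi u v = mk⇔
    (λ ((_ , (loV≤hiU , _)) , ((loU≤hiV , _) , _)) → loU≤hiV , loV≤hiU)
    (λ (loU≤hiV , loV≤hiU) →
      (hi∈stretched u , (loV≤hiU , bound v u)) , ((loU≤hiV , bound u v) , hi∈stretched v))

  mptAdjacent⇔overlap : ∀ u v → MPTAdjacent stretched (hi ∘ I) u v ⇔ Overlap (I u) (I v)
  mptAdjacent⇔overlap u v = ⇔-sym (overlap⇔lo≤hi (I u) (I v)) ⇔-∘ mptAdjacent⇔lo≤hi u v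

interval⇒properMPTG : ∀ {n} (G : Graph n) → IsIntervalGraph G → IsProperMPTG G
interval⇒properMPTG G (I , isIntervalRep) with spreadBound (lo ∘ I) (hi ∘ I)
... | K , bound = stretched , hi ∘ I , (hi∈stretched , mptRep) ,
  λ u v → equalLength⇒¬⊂I K (stretched u) (stretched v) refl refl
  where
  open Stretch I K bound

  mptRep : ∀ u v → ¬ u ≡ v → Adj G u v ⇔ MPTAdjacent stretched (hi ∘ I) u v
  mptRep u v u≢v = ⇔-sym (mptAdjacent⇔overlap u v) ⇔-∘ isIntervalRep u v u≢v

mptAdjacent? : ∀ {n} (I : Fin n → Interval) (p : Fin n → ℚ) u v → Dec (MPTAdjacent I p u v)
mptAdjacent? I p u v =
  ((p u ∈I? I u) ×-dec (p u ∈I? I v)) ×-dec ((p v ∈I? I u) ×-dec (p v ∈I? I v))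

parity : ∀ {n} → Fin n → ℕ
parity u = toℕ u % 2

-- C₄ as K₂,₂ (adjacent iff parities differ): the cycle 0–1–2–3–0.
C₄ : Graph 4
C₄ = record
  { Adj    = λ u v → ¬ parity u ≡ parity v
  ; sym    = λ u≢v u≡v → u≢v (≡.sym u≡v)
  ; irrefl = λ u≢u → u≢u refl
  }

C₄-adjacent? : ∀ u v → Dec (Adj C₄ u v)
C₄-adjacent? u v = ¬? (parity u ℕ.≟ parity v)

c₄Length : ℚ
c₄Length = fromℤ (+ 3)

c₄Interval : Fin 4 → Interval
c₄Interval u = [ a , a + c₄Length ]⟨ p≤p+q a (toWitness {a? = 0ℚ ≤? c₄Length} _) ⟩
  where
  a : ℚ
  a = fromℤ (+ lookup (0 ∷ 1 ∷ 1 ∷ 2 ∷ []) u)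

c₄Point : Fin 4 → ℚ
c₄Point = fromℤ ∘ +_ ∘ lookup (2 ∷ 1 ∷ 4 ∷ 2 ∷ [])

C₄-isMPTGRep : IsMPTGRep C₄ c₄Interval c₄Point
C₄-isMPTGRep =
  toWitness {a? = all? λ u → c₄Point u ∈I? c₄Interval u} _ ,
  toWitness {a? = all? λ u → all? λ v →
    ¬? (u Fin.≟ v) →-dec (C₄-adjacent? u v ⇔? mptAdjacent? c₄Interval c₄Point u v)} _

C₄-isProperMPTG : IsProperMPTG C₄
C₄-isProperMPTG = c₄Interval , c₄Point , C₄-isMPTGRep ,
  λ u v → equalLength⇒¬⊂I c₄Length (c₄Interval u) (c₄Interval v) refl refl

C₄-¬interval : ¬ IsIntervalGraph C₄
C₄-¬interval (I , isIntervalRep) =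
  [ (λ overlap₀₂ → from (isIntervalRep (# 0) (# 2) (λ ())) overlap₀₂ refl)
  , (λ overlap₁₃ → from (isIntervalRep (# 1) (# 3) (λ ())) overlap₁₃ refl)
  ]′ (cyclicOverlap⇒diagonalOverlap (I (# 0)) (I (# 1)) (I (# 2)) (I (# 3))
       (edge (# 0) (# 1) (λ ())) (edge (# 1) (# 2) (λ ()))
       (edge (# 2) (# 3) (λ ())) (edge (# 3) (# 0) (λ ())))
  where
  edge : ∀ u v → Adj C₄ u v → Overlap (I u) (I v)
  edge u v uv = to (isIntervalRep u v λ { refl → irrefl C₄ {u} uv }) uv

corollary3p18 : ((n : ℕ) → (G : Graph n) → IsIntervalGraph G → IsProperMPTG G)
    × Σ ℕ (λ n → Σ (Graph n) (λ G → IsProperMPTG G × ¬ IsIntervalGraph G))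
corollary3p18 = (λ _ → interval⇒properMPTG) , 4 , C₄ , C₄-isProperMPTG , C₄-¬interval
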